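{- Let $H$ be a $\{(4,2),(4,4)\}$-free $3$-graph and let $C_1,C_2$ be distinct tight components of $H$. Then $|V(C_1)\cap V(C_2)|\leq 1$.
   Context: A $3$-graph is a pair $H=(V,E)$ with $E\subseteq\binom{V}{3}$. $H$ is $\{(4,2),(4,4)\}$-free if no $4$-vertex subset of $V(H)$ spans exactly $2$ or exactly $4$ edges. A tight walk from an edge $e$ to an edge $e'$ is a sequence of edges $e=f_1,\dots,f_k=e'$ with $|f_i\cap f_{i+1}|=2$ for all $i$. A tight component is a maximal (under inclusion) set $C$ of edges such that any two distinct edges of $C$ are joined by a tight walk. For a tight component $C$, $V(C)$ denotes the union of the edges in $C$. -}

module Defs where

open import Data.Nat using (ℕ; suc; zero)
open import Data.Bool using (Bool; true; false; if_then_else_)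
open import Data.Fin using (Fin)
open import Data.Fin.Subset using (Subset; _∈_; _∉_; _∩_; ∣_∣; _-_)
open import Data.Fin.Subset.Properties using (_∈?_)
open import Data.List using (List; allFin; filter; length)
open import Relation.Nullary using (¬_; Dec; yes; no)
open import Relation.Nullary.Decidable using (_×-dec_)
open import Relation.Binary.PropositionalEquality using (_≡_)
open import Data.Product using (_×_; Σ; ∃)

record ThreeGraph (n : ℕ) : Set where
  field
    isEdge   : Subset n → Bool
    edgeSize : ∀ e → isEdge e ≡ true → ∣ e ∣ ≡ 3

open ThreeGraph public

Edge : ∀ {n} → ThreeGraph n → Subset n → Set
Edge H e = isEdge H e ≡ true

-- number of edges of H spanned by the set S: the 3-subsets of a 4-set S
-- are exactly S - {v} for v ∈ S.  For |S| = 4 this counts the edges inside S.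
edgesIn : ∀ {n} → ThreeGraph n → Subset n → ℕ
edgesIn {n} H S = length (filter (λ v → (v ∈? S) ×-dec (isEdge H (S - v) Data.Bool.≟ true)) (allFin n))

Free42-44 : ∀ {n} → ThreeGraph n → Set
Free42-44 H = ∀ S → ∣ S ∣ ≡ 4 → ¬ (edgesIn H S ≡ 2) × ¬ (edgesIn H S ≡ 4)

data TightWalk {n} (H : ThreeGraph n) : Subset n → Subset n → Set where
  single : ∀ {e} → Edge H e → TightWalk H e e
  step   : ∀ {e f g} → Edge H e → ∣ e ∩ f ∣ ≡ 2 → TightWalk H f g → TightWalk H e g

EdgeSet : ℕ → Set₁
EdgeSet n = Subset n → Set

_⊆E_ : ∀ {n} → EdgeSet n → EdgeSet n → Set
C ⊆E D = ∀ e → C e → D e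

Connected : ∀ {n} → ThreeGraph n → EdgeSet n → Set
Connected H C = (∀ e → C e → Edge H e)
              × (∀ e f → C e → C f → ¬ (e ≡ f) → TightWalk H e f)

TightComponent : ∀ {n} → ThreeGraph n → EdgeSet n → Set₁
TightComponent H C = Connected H C × (∀ D → C ⊆E D → Connected H D → D ⊆E C)

VertexOf : ∀ {n} → EdgeSet n → Fin n → Set
VertexOf C v = ∃ λ e → C e × v ∈ e

DistinctE : ∀ {n} → EdgeSet n → EdgeSet n → Set
DistinctE C D = ¬ (C ⊆E D × D ⊆E C)

-- Call x near an edge g if x ∈ g or x forms an edge with two vertices of g.  Freeness says
-- that every 4-set spans 0, 1 or 3 edges, so two edges abp, abq force exactly one of apq, bpq;
-- a short case analysis with this fact shows that nearness is preserved along tight walks.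
-- If u ≠ w both lie in V(C₁) ∩ V(C₂), then in each Cᵢ the vertex u is near an edge containing
-- w, and from there a tight walk reaches an edge containing both u and w.  Two edges through
-- u and w are equal or tightly adjacent, so C₁ and C₂ are joined by a tight walk and, being
-- maximal, coincide.

module Submission where

open import Defs

open import Data.Nat using (ℕ; zero; suc; _≤_; s≤s)
open import Data.Bool using (true; false) renaming (_≟_ to _≟ᵇ_)
open import Data.Nat.Properties using (suc-injective; m≤n⇒m≤1+n; 1+n≰n; ≤-reflexive)
open import Data.Fin using (Fin; zero; suc)
open import Data.Fin.Properties using (_≟_)
open import Data.Fin.Subset using () renaming (⊥ to ∅)
open import Data.Fin.Subset using (Subset; Nonempty; inside; outside; ⁅_⁆; _∪_; _∩_; _∈_; _∉_; _-_; ∣_∣)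
open import Data.Fin.Subset.Properties
  using ( x∈⁅x⁆; x∈⁅y⁆⇒x≡y; x∈p∪q⁺; x∈p∪q⁻; x∈p∩q⁺; x∈p∩q⁻; ∉⊥; ∣⊥∣≡0; ⊆-antisym
        ; p─⊥≡p; p─q⊆p; x∈p∧x≢y⇒x∈p-y; ∩-comm; ∩-idem )
open import Data.List using (List; []; _∷_; foldr; length; filter; allFin)
import Data.List as List
open import Data.Vec using (_∷_; here; there; tabulate)
open import Data.Vec.Properties using (lookup∘tabulate; []=⇒lookup; lookup⇒[]=; ≡-dec)
open import Data.List.Membership.Propositional using () renaming (_∈_ to _∈ₗ_; _∉_ to _∉ₗ_)
import Data.List.Membership.DecPropositional as DecMembership
open import Data.List.Relation.Unary.Any using (here; there)
open import Data.List.Relation.Unary.All using (All; []; _∷_)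
open import Data.List.Relation.Unary.All.Properties using (¬Any⇒All¬; All¬⇒¬Any)
open import Data.List.Relation.Unary.AllPairs using ([]; _∷_)
open import Data.List.Relation.Unary.Unique.Propositional using (Unique)
open import Data.List.Relation.Unary.Unique.Propositional.Properties using (Unique[x∷xs]⇒x∉xs; drop⁺)
open import Data.List.Relation.Binary.Permutation.Propositional
  using (_↭_; refl; prep; swap; ↭-trans; ↭-sym; ↭⇒↭ₛ)
open import Data.List.Relation.Binary.Permutation.Propositional.Properties using (∈-resp-↭)
import Data.List.Relation.Binary.Permutation.Setoid.Properties as Permₛ
open import Data.Product using (∃; ∃₂; _×_; _,_; proj₁; proj₂)
open import Data.Empty using (⊥; ⊥-elim)
open import Data.Sum using (_⊎_; inj₁; inj₂)
open import Function using (_∘_)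
open import Relation.Nullary using (¬_; Dec; yes; no; does; contradiction)
open import Relation.Nullary.Decidable using (dec-true)
open import Relation.Unary using (Pred; Decidable)
open import Relation.Binary.PropositionalEquality using (_≡_; _≢_; refl; sym; trans; cong; subst; setoid; ≢-sym)

private
  variable
    n : ℕ
    x y : Fin n
    p : Subset n
    xs ys : List (Fin n)

-- Finite sets listed by their elements

fromList : List (Fin n) → Subset n
fromList = foldr (λ x s → ⁅ x ⁆ ∪ s) ∅

∈-fromList⁺ : ∀ xs → x ∈ₗ xs → x ∈ fromList xs
∈-fromList⁺ (x ∷ _)  (here refl)  = x∈p∪q⁺ (inj₁ (x∈⁅x⁆ x))
∈-fromList⁺ (_ ∷ xs) (there x∈xs) = x∈p∪q⁺ (inj₂ (∈-fromList⁺ xs x∈xs))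

∈-fromList⁻ : ∀ xs → x ∈ fromList xs → x ∈ₗ xs
∈-fromList⁻ []       x∈⊥ = contradiction x∈⊥ ∉⊥
∈-fromList⁻ (y ∷ xs) x∈ with x∈p∪q⁻ ⁅ y ⁆ (fromList xs) x∈
... | inj₁ x∈⁅y⁆ = here (x∈⁅y⁆⇒x≡y y x∈⁅y⁆)
... | inj₂ x∈xs = there (∈-fromList⁻ xs x∈xs)

fromList-cong : (∀ {x} → x ∈ₗ xs → x ∈ₗ ys) → (∀ {x} → x ∈ₗ ys → x ∈ₗ xs) →
                fromList xs ≡ fromList ys
fromList-cong {xs = xs} {ys = ys} xs⊆ys ys⊆xs =
  ⊆-antisym (∈-fromList⁺ ys ∘ xs⊆ys ∘ ∈-fromList⁻ xs) (∈-fromList⁺ xs ∘ ys⊆xs ∘ ∈-fromList⁻ ys)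

fromList-↭ : xs ↭ ys → fromList xs ≡ fromList ys
fromList-↭ σ = fromList-cong (∈-resp-↭ σ) (∈-resp-↭ (↭-sym σ))

x∉p-x : ∀ (p : Subset n) → x ∉ p - x
x∉p-x {x = zero}  (_ ∷ p) ()
x∉p-x {x = suc x} (_ ∷ p) (there x∈p-x) = x∉p-x p x∈p-x

x∈p⇒x≡y⊎x∈p-y : ∀ y → x ∈ p → x ≡ y ⊎ x ∈ p - y
x∈p⇒x≡y⊎x∈p-y {x = x} y x∈p with x ≟ y
... | yes x≡y = inj₁ x≡y
... | no  x≢y = inj₂ (x∈p∧x≢y⇒x∈p-y x∈p x≢y)

x∈p-y⇒x≢y : x ∈ p - y → x ≢ y
x∈p-y⇒x≢y {p = p} x∈p-y refl = x∉p-x p x∈p-y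

∣p∣≡1+∣p-x∣ : x ∈ p → ∣ p ∣ ≡ suc ∣ p - x ∣
∣p∣≡1+∣p-x∣ {p = inside  ∷ p} here        = cong (suc ∘ ∣_∣) (sym (p─⊥≡p p))
∣p∣≡1+∣p-x∣ {p = inside  ∷ p} (there x∈p) = cong suc (∣p∣≡1+∣p-x∣ x∈p)
∣p∣≡1+∣p-x∣ {p = outside ∷ p} (there x∈p) = ∣p∣≡1+∣p-x∣ x∈p

∣p∣≡1+k⇒∣p-x∣≡k : ∀ {k} → x ∈ p → ∣ p ∣ ≡ suc k → ∣ p - x ∣ ≡ k
∣p∣≡1+k⇒∣p-x∣≡k x∈p ∣p∣≡1+k = suc-injective (trans (sym (∣p∣≡1+∣p-x∣ x∈p)) ∣p∣≡1+k)

x∈p⇒∣p∣≢0 : x ∈ p → ∣ p ∣ ≢ 0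
x∈p⇒∣p∣≢0 x∈p ∣p∣≡0 with trans (sym ∣p∣≡0) (∣p∣≡1+∣p-x∣ x∈p)
... | ()

fromList-remove : x ∉ₗ xs → fromList (x ∷ xs) - x ≡ fromList xs
fromList-remove {x = x} {xs = xs} x∉xs = ⊆-antisym to from
  where
  to : ∀ {y} → y ∈ fromList (x ∷ xs) - x → y ∈ fromList xs
  to y∈ with ∈-fromList⁻ (x ∷ xs) (p─q⊆p _ ⁅ x ⁆ y∈)
  ... | here y≡x    = contradiction y≡x (x∈p-y⇒x≢y y∈)
  ... | there y∈xs = ∈-fromList⁺ xs y∈xs
  from : ∀ {y} → y ∈ fromList xs → y ∈ fromList (x ∷ xs) - x
  from y∈ = x∈p∧x≢y⇒x∈p-y (∈-fromList⁺ (x ∷ xs) (there (∈-fromList⁻ xs y∈)))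
                          (λ { refl → x∉xs (∈-fromList⁻ xs y∈) })

∉-fromList : All (x ≢_) xs → x ∉ fromList xs
∉-fromList {xs = xs} x≢xs x∈xs = All¬⇒¬Any x≢xs (∈-fromList⁻ xs x∈xs)

∣fromList∷∣ : x ∉ₗ xs → ∣ fromList (x ∷ xs) ∣ ≡ suc ∣ fromList xs ∣
∣fromList∷∣ {x = x} {xs = xs} x∉xs =
  trans (∣p∣≡1+∣p-x∣ (∈-fromList⁺ (x ∷ xs) (here refl))) (cong (suc ∘ ∣_∣) (fromList-remove x∉xs))

fromList-dup : x ∈ₗ xs → fromList (x ∷ xs) ≡ fromList xs
fromList-dup x∈xs = fromList-cong (λ { (here refl) → x∈xs ; (there y∈xs) → y∈xs }) there

∣fromList∣≤length : ∀ (xs : List (Fin n)) → ∣ fromList xs ∣ ≤ length xs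
∣fromList∣≤length {n = n} [] = ≤-reflexive (∣⊥∣≡0 n)
∣fromList∣≤length (x ∷ xs) with DecMembership._∈?_ _≟_ x xs
... | yes x∈xs = m≤n⇒m≤1+n (subst (_≤ length xs) (cong ∣_∣ (sym (fromList-dup x∈xs))) (∣fromList∣≤length xs))
... | no  x∉xs = subst (_≤ suc (length xs)) (sym (∣fromList∷∣ x∉xs)) (s≤s (∣fromList∣≤length xs))

Unique⇒∣fromList∣≡length : ∀ {n} {xs : List (Fin n)} → Unique xs → ∣ fromList xs ∣ ≡ length xs
Unique⇒∣fromList∣≡length {n} {[]} _ = ∣⊥∣≡0 n
Unique⇒∣fromList∣≡length {xs = x ∷ xs} u@(_ ∷ xs-unique) =
  trans (∣fromList∷∣ (Unique[x∷xs]⇒x∉xs u)) (cong suc (Unique⇒∣fromList∣≡length xs-unique))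

∣fromList∣≡length⇒Unique : ∀ (xs : List (Fin n)) → ∣ fromList xs ∣ ≡ length xs → Unique xs
∣fromList∣≡length⇒Unique []       _ = []
∣fromList∣≡length⇒Unique (x ∷ xs) eq with DecMembership._∈?_ _≟_ x xs
... | yes x∈xs = contradiction (subst (_≤ length xs) (trans (cong ∣_∣ (sym (fromList-dup x∈xs))) eq)
                                       (∣fromList∣≤length xs)) 1+n≰n
... | no  x∉xs = ¬Any⇒All¬ xs x∉xs
                 ∷ ∣fromList∣≡length⇒Unique xs (suc-injective (trans (sym (∣fromList∷∣ x∉xs)) eq))

fromList-remove-↭ : ∀ {n} {xs ys : List (Fin n)} {x} →
                    Unique xs → xs ↭ x ∷ ys → fromList xs - x ≡ fromList ys
fromList-remove-↭ {n} xs-unique σ =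
  trans (cong (_- _) (fromList-↭ σ))
        (fromList-remove (Unique[x∷xs]⇒x∉xs (Permₛ.Unique-resp-↭ (setoid (Fin n)) (↭⇒↭ₛ σ) xs-unique)))

∣p∣≡1+k⇒Nonempty : ∀ (p : Subset n) {k} → ∣ p ∣ ≡ suc k → Nonempty p
∣p∣≡1+k⇒Nonempty (inside  ∷ p) _  = zero , here
∣p∣≡1+k⇒Nonempty (outside ∷ p) eq with ∣p∣≡1+k⇒Nonempty p eq
... | x , x∈p = suc x , there x∈p

∣p∣≡1⇒≡ : ∣ p ∣ ≡ 1 → x ∈ p → y ∈ p → x ≡ y
∣p∣≡1⇒≡ {y = y} ∣p∣≡1 x∈p y∈p with x∈p⇒x≡y⊎x∈p-y y x∈p
... | inj₁ x≡y   = x≡y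
... | inj₂ x∈p-y = contradiction (∣p∣≡1+k⇒∣p-x∣≡k y∈p ∣p∣≡1) (x∈p⇒∣p∣≢0 x∈p-y)

∣p∣≡2⇒pair : ∣ p ∣ ≡ 2 → ∃₂ λ a b → a ∈ p × b ∈ p × a ≢ b
∣p∣≡2⇒pair {p = p} ∣p∣≡2 with ∣p∣≡1+k⇒Nonempty p ∣p∣≡2
... | a , a∈p with ∣p∣≡1+k⇒Nonempty (p - a) (∣p∣≡1+k⇒∣p-x∣≡k a∈p ∣p∣≡2)
... | b , b∈p-a = a , b , a∈p , p─q⊆p p ⁅ a ⁆ b∈p-a , ≢-sym (x∈p-y⇒x≢y b∈p-a)

∣p∣≡3⇒triple : ∀ {a b} → ∣ p ∣ ≡ 3 → a ∈ p → b ∈ p → a ≢ b →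
               ∃ λ c → p ≡ fromList (a ∷ b ∷ c ∷ [])
∣p∣≡3⇒triple {p = p} {a} {b} ∣p∣≡3 a∈p b∈p a≢b =
  c , ⊆-antisym (∈-fromList⁺ _ ∘ to) (from ∘ ∈-fromList⁻ _)
  where
  b∈p-a : b ∈ p - a
  b∈p-a = x∈p∧x≢y⇒x∈p-y b∈p (≢-sym a≢b)
  ∣p-a-b∣≡1 : ∣ p - a - b ∣ ≡ 1
  ∣p-a-b∣≡1 = ∣p∣≡1+k⇒∣p-x∣≡k b∈p-a (∣p∣≡1+k⇒∣p-x∣≡k a∈p ∣p∣≡3)
  c : Fin _
  c = proj₁ (∣p∣≡1+k⇒Nonempty (p - a - b) ∣p-a-b∣≡1)
  c∈p-a-b : c ∈ p - a - b
  c∈p-a-b = proj₂ (∣p∣≡1+k⇒Nonempty (p - a - b) ∣p-a-b∣≡1)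
  to : ∀ {x} → x ∈ p → x ∈ₗ a ∷ b ∷ c ∷ []
  to x∈p with x∈p⇒x≡y⊎x∈p-y a x∈p
  ... | inj₁ refl = here refl
  ... | inj₂ x∈p-a with x∈p⇒x≡y⊎x∈p-y b x∈p-a
  ...   | inj₁ refl      = there (here refl)
  ...   | inj₂ x∈p-a-b = there (there (here (∣p∣≡1⇒≡ ∣p-a-b∣≡1 x∈p-a-b c∈p-a-b)))
  from : ∀ {x} → x ∈ₗ a ∷ b ∷ c ∷ [] → x ∈ p
  from (here refl)                 = a∈p
  from (there (here refl))         = b∈p
  from (there (there (here refl))) = p─q⊆p p ⁅ a ⁆ (p─q⊆p (p - a) ⁅ b ⁆ c∈p-a-b)

length-filter-tabulate : ∀ {ℓ m} {P : Pred (Fin m) ℓ} (P? : Decidable P) (f : Fin n → Fin m) →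
  length (filter P? (List.tabulate f)) ≡ ∣ tabulate (λ i → does (P? (f i))) ∣
length-filter-tabulate {n = zero}  P? f = refl
length-filter-tabulate {n = suc n} P? f with does (P? (f zero))
... | true  = cong suc (length-filter-tabulate P? (λ i → f (suc i)))
... | false = length-filter-tabulate P? (λ i → f (suc i))

∈-tabulate-does⁻ : ∀ {ℓ} {P : Pred (Fin n) ℓ} (P? : Decidable P) → x ∈ tabulate (does ∘ P?) → P x
∈-tabulate-does⁻ {x = x} P? x∈ with P? x | trans (sym (lookup∘tabulate (does ∘ P?) x)) ([]=⇒lookup x∈)
... | yes px | _ = px

∈-tabulate-does⁺ : ∀ {ℓ} {P : Pred (Fin n) ℓ} (P? : Decidable P) → P x → x ∈ tabulate (does ∘ P?)
∈-tabulate-does⁺ {x = x} P? px = lookup⇒[]= x _ (trans (lookup∘tabulate (does ∘ P?) x) (dec-true (P? x) px))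

length-filter≡∣p∣ : ∀ {ℓ} {P : Pred (Fin n) ℓ} (P? : Decidable P) →
  (∀ {x} → P x → x ∈ p) → (∀ {x} → x ∈ p → P x) → length (filter P? (allFin n)) ≡ ∣ p ∣
length-filter≡∣p∣ P? P⊆p p⊆P =
  trans (length-filter-tabulate P? (λ x → x))
        (cong ∣_∣ (⊆-antisym (P⊆p ∘ ∈-tabulate-does⁻ P?) (∈-tabulate-does⁺ P? ∘ p⊆P)))

-- Tight walks and components

module _ {n} {H : ThreeGraph n} where

  walk-source : ∀ {e f} → TightWalk H e f → Edge H e
  walk-source (single e∈H)   = e∈H
  walk-source (step e∈H _ _) = e∈H

  walk-target : ∀ {e f} → TightWalk H e f → Edge H f
  walk-target (single f∈H) = f∈H
  walk-target (step _ _ w) = walk-target w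

  infixr 5 _++ʷ_

  _++ʷ_ : ∀ {e f g} → TightWalk H e f → TightWalk H f g → TightWalk H e g
  single _      ++ʷ w′ = w′
  step e∈H ∣∩∣ w ++ʷ w′ = step e∈H ∣∩∣ (w ++ʷ w′)

  reverseʷ : ∀ {e f} → TightWalk H e f → TightWalk H f e
  reverseʷ (single e∈H) = single e∈H
  reverseʷ {e} (step {f = f} e∈H ∣e∩f∣≡2 w) =
    reverseʷ w ++ʷ step (walk-source w) (trans (cong ∣_∣ (∩-comm f e)) ∣e∩f∣≡2) (single e∈H)

  connected-walk : ∀ {C e f} → Connected H C → C e → C f → TightWalk H e f
  connected-walk {e = e} {f} (edges , walks) e∈C f∈C with ≡-dec _≟ᵇ_ e f
  ... | yes refl = single (edges e e∈C)
  ... | no  e≢f  = walks e f e∈C f∈C e≢f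

  linked-components-coincide : ∀ {C₁ C₂ e f} → TightComponent H C₁ → TightComponent H C₂ →
    C₁ e → C₂ f → TightWalk H e f → C₁ ⊆E C₂ × C₂ ⊆E C₁
  linked-components-coincide {C₁} {C₂} {e} {f} (conn₁ , max₁) (conn₂ , max₂) e∈C₁ f∈C₂ e⇝f =
    (λ g g∈C₁ → max₂ C₁∪C₂ (λ _ → inj₂) union-connected g (inj₁ g∈C₁)) ,
    (λ g g∈C₂ → max₁ C₁∪C₂ (λ _ → inj₁) union-connected g (inj₂ g∈C₂))
    where
    C₁∪C₂ : EdgeSet n
    C₁∪C₂ g = C₁ g ⊎ C₂ g
    across : ∀ {g g′} → C₁ g → C₂ g′ → TightWalk H g g′
    across g∈C₁ g′∈C₂ =
      connected-walk conn₁ g∈C₁ e∈C₁ ++ʷ e⇝f ++ʷ connected-walk conn₂ f∈C₂ g′∈C₂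
    union-connected : Connected H C₁∪C₂
    union-connected = edges , walks
      where
      edges : ∀ g → C₁∪C₂ g → Edge H g
      edges g (inj₁ g∈C₁) = proj₁ conn₁ g g∈C₁
      edges g (inj₂ g∈C₂) = proj₁ conn₂ g g∈C₂
      walks : ∀ g g′ → C₁∪C₂ g → C₁∪C₂ g′ → g ≢ g′ → TightWalk H g g′
      walks g g′ (inj₁ g∈C₁) (inj₁ g′∈C₁) g≢g′ = proj₂ conn₁ g g′ g∈C₁ g′∈C₁ g≢g′
      walks g g′ (inj₂ g∈C₂) (inj₂ g′∈C₂) g≢g′ = proj₂ conn₂ g g′ g∈C₂ g′∈C₂ g≢g′
      walks g g′ (inj₁ g∈C₁) (inj₂ g′∈C₂) _    = across g∈C₁ g′∈C₂
      walks g g′ (inj₂ g∈C₂) (inj₁ g′∈C₁) _    = reverseʷ (across g′∈C₁ g∈C₂)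

-- {(4,2),(4,4)}-free 3-graphs

module Free42-44Graph {n} (H : ThreeGraph n) (free : Free42-44 H) where

  private
    variable
      a b c d : Fin n

  triple : Fin n → Fin n → Fin n → Subset n
  triple a b c = fromList (a ∷ b ∷ c ∷ [])

  ∈₁ : ∀ {a b c} → a ∈ triple a b c
  ∈₁ {a} {b} {c} = ∈-fromList⁺ (a ∷ b ∷ c ∷ []) (here refl)

  ∈₂ : ∀ {a b c} → b ∈ triple a b c
  ∈₂ {a} {b} {c} = ∈-fromList⁺ (a ∷ b ∷ c ∷ []) (there (here refl))

  ∈₃ : ∀ {a b c} → c ∈ triple a b c
  ∈₃ {a} {b} {c} = ∈-fromList⁺ (a ∷ b ∷ c ∷ []) (there (there (here refl)))

  Edge₃ : Fin n → Fin n → Fin n → Set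
  Edge₃ a b c = Edge H (triple a b c)

  Edge₃-↭ : ∀ {a′ b′ c′} → (a ∷ b ∷ c ∷ []) ↭ (a′ ∷ b′ ∷ c′ ∷ []) →
            Edge₃ a b c → Edge₃ a′ b′ c′
  Edge₃-↭ σ = subst (Edge H) (fromList-↭ σ)

  swap₁₂ : Edge₃ a b c → Edge₃ b a c
  swap₁₂ = Edge₃-↭ (swap _ _ refl)

  swap₂₃ : Edge₃ a b c → Edge₃ a c b
  swap₂₃ = Edge₃-↭ (prep _ (swap _ _ refl))

  rotate : Edge₃ a b c → Edge₃ b c a
  rotate = swap₂₃ ∘ swap₁₂

  Edge₃-distinct : Edge₃ a b c → a ≢ b × a ≢ c × b ≢ c
  Edge₃-distinct {a} {b} {c} abc with ∣fromList∣≡length⇒Unique (a ∷ b ∷ c ∷ []) (edgeSize H _ abc)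
  ... | (a≢b ∷ a≢c ∷ []) ∷ (b≢c ∷ []) ∷ [] ∷ [] = a≢b , a≢c , b≢c

  Spans : Subset n → Fin n → Set
  Spans S v = v ∈ S × Edge H (S - v)

  module Quadruple {a b c d : Fin n} (distinct : Unique (a ∷ b ∷ c ∷ d ∷ [])) where
    S : Subset n
    S = fromList (a ∷ b ∷ c ∷ d ∷ [])

    ∈S : ∀ {v} → v ∈ₗ a ∷ b ∷ c ∷ d ∷ [] → v ∈ S
    ∈S = ∈-fromList⁺ (a ∷ b ∷ c ∷ d ∷ [])

    ∈S⁻ : ∀ {v} → v ∈ S → v ∈ₗ a ∷ b ∷ c ∷ d ∷ []
    ∈S⁻ = ∈-fromList⁻ (a ∷ b ∷ c ∷ d ∷ [])

    ∣S∣≡4 : ∣ S ∣ ≡ 4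
    ∣S∣≡4 = Unique⇒∣fromList∣≡length distinct

    S-a : S - a ≡ triple b c d
    S-a = fromList-remove-↭ distinct refl
    S-b : S - b ≡ triple a c d
    S-b = fromList-remove-↭ distinct (swap a b refl)
    S-c : S - c ≡ triple a b d
    S-c = fromList-remove-↭ distinct (↭-trans (prep a (swap b c refl)) (swap a c refl))
    S-d : S - d ≡ triple a b c
    S-d = fromList-remove-↭ distinct
            (↭-trans (prep a (prep b (swap c d refl))) (↭-trans (prep a (swap b d refl)) (swap a d refl)))

    edgesIn-two : Edge₃ a b c → Edge₃ a b d → ¬ Edge₃ b c d → ¬ Edge₃ a c d → edgesIn H S ≡ 2
    edgesIn-two abc abd ¬bcd ¬acd =
      trans (length-filter≡∣p∣ _ spans⇒∈ ∈⇒spans) (Unique⇒∣fromList∣≡length (drop⁺ 2 distinct))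
      where
      spans⇒∈ : ∀ {v} → Spans S v → v ∈ fromList (c ∷ d ∷ [])
      spans⇒∈ (v∈S , S-v∈H) with ∈S⁻ v∈S
      ... | here refl                         = contradiction (subst (Edge H) S-a S-v∈H) ¬bcd
      ... | there (here refl)                 = contradiction (subst (Edge H) S-b S-v∈H) ¬acd
      ... | there (there (here refl))         = ∈-fromList⁺ (c ∷ d ∷ []) (here refl)
      ... | there (there (there (here refl))) = ∈-fromList⁺ (c ∷ d ∷ []) (there (here refl))
      ... | there (there (there (there ())))
      ∈⇒spans : ∀ {v} → v ∈ fromList (c ∷ d ∷ []) → Spans S v
      ∈⇒spans v∈ with ∈-fromList⁻ (c ∷ d ∷ []) v∈
      ... | here refl         = ∈S (there (there (here refl))) , subst (Edge H) (sym S-c) abd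
      ... | there (here refl) = ∈S (there (there (there (here refl)))) , subst (Edge H) (sym S-d) abc
      ... | there (there ())

    edgesIn-four : Edge₃ b c d → Edge₃ a c d → Edge₃ a b d → Edge₃ a b c → edgesIn H S ≡ 4
    edgesIn-four bcd acd abd abc = trans (length-filter≡∣p∣ _ proj₁ spans) ∣S∣≡4
      where
      spans : ∀ {v} → v ∈ S → Spans S v
      spans v∈S with ∈S⁻ v∈S
      ... | here refl                         = v∈S , subst (Edge H) (sym S-a) bcd
      ... | there (here refl)                 = v∈S , subst (Edge H) (sym S-b) acd
      ... | there (there (here refl))         = v∈S , subst (Edge H) (sym S-c) abd
      ... | there (there (there (here refl))) = v∈S , subst (Edge H) (sym S-d) abc
      ... | there (there (there (there ())))

  quadruple-unique : Edge₃ a b c → Edge₃ a b d → c ≢ d → Unique (a ∷ b ∷ c ∷ d ∷ [])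
  quadruple-unique abc abd c≢d with Edge₃-distinct abc | Edge₃-distinct abd
  ... | a≢b , a≢c , b≢c | _ , a≢d , b≢d =
    (a≢b ∷ a≢c ∷ a≢d ∷ []) ∷ (b≢c ∷ b≢d ∷ []) ∷ (c≢d ∷ []) ∷ [] ∷ []

  edge? : ∀ e → Dec (Edge H e)
  edge? e = isEdge H e ≟ᵇ true

  third-edge : Edge₃ a b c → Edge₃ a b d → c ≢ d → Edge₃ b c d ⊎ Edge₃ a c d
  third-edge {a} {b} {c} {d} abc abd c≢d with edge? (triple b c d) | edge? (triple a c d)
  ... | yes bcd | _       = inj₁ bcd
  ... | no _    | yes acd = inj₂ acd
  ... | no ¬bcd | no ¬acd = contradiction (edgesIn-two abc abd ¬bcd ¬acd) (proj₁ (free S ∣S∣≡4))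
    where open Quadruple (quadruple-unique abc abd c≢d)

  no-four-edges : Edge₃ a b c → Edge₃ a b d → Edge₃ a c d → Edge₃ b c d → ⊥
  no-four-edges abc abd acd bcd = proj₂ (free S ∣S∣≡4) (edgesIn-four bcd acd abd abc)
    where open Quadruple (quadruple-unique abc abd (proj₂ (proj₂ (Edge₃-distinct acd))))

  Attached : Fin n → Fin n → Fin n → Fin n → Set
  Attached x a b c = Edge₃ x a b ⊎ Edge₃ x a c ⊎ Edge₃ x b c

  reattach : ∀ {a b x p q} → x ≢ b → x ≢ q → p ≢ q →
             Edge₃ a b p → Edge₃ a b q → Edge₃ x a p → Attached x a b q
  reattach {a} {b} {x} {p} {q} x≢b x≢q p≢q abp abq xap
    with third-edge (swap₂₃ abp) (rotate xap) (≢-sym x≢b)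
  ... | inj₂ abx = inj₁ (rotate (rotate abx))
  ... | inj₁ pbx = via (third-edge abp abq p≢q)
    where
    a≢q : a ≢ q
    a≢q = proj₁ (proj₂ (Edge₃-distinct abq))
    b≢q : b ≢ q
    b≢q = proj₂ (proj₂ (Edge₃-distinct abq))
    via : Edge₃ b p q ⊎ Edge₃ a p q → Attached x a b q
    via (inj₁ bpq) with third-edge pbx (swap₁₂ bpq) x≢q
    ... | inj₁ bxq = inj₂ (inj₂ (swap₁₂ bxq))
    ... | inj₂ pxq with third-edge (rotate (rotate xap)) pxq a≢q
    ...   | inj₁ xaq = inj₂ (inj₁ xaq)
    ...   | inj₂ paq = ⊥-elim (no-four-edges abp abq (swap₁₂ paq) bpq)
    via (inj₂ apq) with third-edge (rotate xap) apq x≢q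
    ... | inj₂ axq = inj₂ (inj₁ (swap₁₂ axq))
    ... | inj₁ pxq with third-edge (swap₂₃ pbx) pxq b≢q
    ...   | inj₁ xbq = inj₂ (inj₂ xbq)
    ...   | inj₂ pbq = ⊥-elim (no-four-edges abp abq apq (swap₁₂ pbq))

  Attached-step : ∀ {x a b p q} → x ≢ a → x ≢ b → x ≢ q → p ≢ q →
                  Edge₃ a b p → Edge₃ a b q → Attached x a b p → Attached x a b q
  Attached-step _ _ _ _ _ _ (inj₁ xab) = inj₁ xab
  Attached-step _ x≢b x≢q p≢q abp abq (inj₂ (inj₁ xap)) = reattach x≢b x≢q p≢q abp abq xap
  Attached-step x≢a _ x≢q p≢q abp abq (inj₂ (inj₂ xbp))
    with reattach x≢a x≢q p≢q (swap₁₂ abp) (swap₁₂ abq) xbp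
  ... | inj₁ xba        = inj₁ (swap₂₃ xba)
  ... | inj₂ (inj₁ xbq) = inj₂ (inj₂ xbq)
  ... | inj₂ (inj₂ xaq) = inj₂ (inj₁ xaq)

  Near : Fin n → Subset n → Set
  Near x g = x ∈ g ⊎ ∃₂ λ a b → a ∈ g × b ∈ g × Edge₃ x a b

  Attached⇒Near : ∀ {x a b c} → Attached x a b c → Near x (triple a b c)
  Attached⇒Near (inj₁ xab)        = inj₂ (_ , _ , ∈₁ , ∈₂ , xab)
  Attached⇒Near (inj₂ (inj₁ xac)) = inj₂ (_ , _ , ∈₁ , ∈₃ , xac)
  Attached⇒Near (inj₂ (inj₂ xbc)) = inj₂ (_ , _ , ∈₂ , ∈₃ , xbc)

  Near⇒Attached : ∀ {x a b c} → x ∉ triple a b c → Near x (triple a b c) → Attached x a b c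
  Near⇒Attached x∉abc (inj₁ x∈abc) = contradiction x∈abc x∉abc
  Near⇒Attached {a = a} {b} {c} _ (inj₂ (a′ , b′ , a′∈ , b′∈ , xa′b′))
    with proj₂ (proj₂ (Edge₃-distinct xa′b′))
       | ∈-fromList⁻ (a ∷ b ∷ c ∷ []) a′∈ | ∈-fromList⁻ (a ∷ b ∷ c ∷ []) b′∈
  ... | a′≢b′ | here refl                 | here refl                 = contradiction refl a′≢b′
  ... | a′≢b′ | here refl                 | there (here refl)         = inj₁ xa′b′
  ... | a′≢b′ | here refl                 | there (there (here refl)) = inj₂ (inj₁ xa′b′)
  ... | a′≢b′ | there (here refl)         | here refl                 = inj₁ (swap₂₃ xa′b′)
  ... | a′≢b′ | there (here refl)         | there (here refl)         = contradiction refl a′≢b′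
  ... | a′≢b′ | there (here refl)         | there (there (here refl)) = inj₂ (inj₂ xa′b′)
  ... | a′≢b′ | there (there (here refl)) | here refl                 = inj₂ (inj₁ (swap₂₃ xa′b′))
  ... | a′≢b′ | there (there (here refl)) | there (here refl)         = inj₂ (inj₂ (swap₂₃ xa′b′))
  ... | a′≢b′ | there (there (here refl)) | there (there (here refl)) = contradiction refl a′≢b′
  ... | _     | there (there (there ()))  | _
  ... | _     | _                         | there (there (there ()))

  Near-step : ∀ {x a b p q} → Edge₃ a b p → Edge₃ a b q → p ≢ q →
              Near x (triple a b p) → Near x (triple a b q)
  Near-step {x} {a} {b} {p} {q} abp abq p≢q near with x ≟ a | x ≟ b | x ≟ q | x ≟ p
  ... | yes refl | _        | _        | _        = inj₁ ∈₁
  ... | no _     | yes refl | _        | _        = inj₁ ∈₂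
  ... | no _     | no _     | yes refl | _        = inj₁ ∈₃
  ... | no _     | no _     | no _     | yes refl = Attached⇒Near (p-attached (third-edge abp abq p≢q))
    where
    p-attached : Edge₃ b p q ⊎ Edge₃ a p q → Attached p a b q
    p-attached (inj₁ bpq) = inj₂ (inj₂ (swap₁₂ bpq))
    p-attached (inj₂ apq) = inj₂ (inj₁ (swap₁₂ apq))
  ... | no x≢a   | no x≢b   | no x≢q   | no x≢p   =
    Attached⇒Near (Attached-step x≢a x≢b x≢q p≢q abp abq
                    (Near⇒Attached (∉-fromList (x≢a ∷ x≢b ∷ x≢p ∷ [])) near))

  ∣triple∩triple∣ : ∀ {a b c d} → Edge₃ a b c → Edge₃ a b d → c ≢ d →
                    ∣ triple a b c ∩ triple a b d ∣ ≡ 2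
  ∣triple∩triple∣ {a} {b} {c} {d} abc abd c≢d with Edge₃-distinct abc
  ... | a≢b , a≢c , b≢c =
    trans (cong ∣_∣ (⊆-antisym to from)) (Unique⇒∣fromList∣≡length ((a≢b ∷ []) ∷ [] ∷ []))
    where
    c∉abd : c ∉ triple a b d
    c∉abd = ∉-fromList (≢-sym a≢c ∷ ≢-sym b≢c ∷ c≢d ∷ [])
    to : ∀ {v} → v ∈ triple a b c ∩ triple a b d → v ∈ fromList (a ∷ b ∷ [])
    to v∈ with x∈p∩q⁻ (triple a b c) (triple a b d) v∈
    ... | v∈abc , v∈abd with ∈-fromList⁻ (a ∷ b ∷ c ∷ []) v∈abc
    ...   | here refl                 = ∈-fromList⁺ (a ∷ b ∷ []) (here refl)
    ...   | there (here refl)         = ∈-fromList⁺ (a ∷ b ∷ []) (there (here refl))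
    ...   | there (there (here refl)) = contradiction v∈abd c∉abd
    ...   | there (there (there ()))
    from : ∀ {v} → v ∈ fromList (a ∷ b ∷ []) → v ∈ triple a b c ∩ triple a b d
    from v∈ with ∈-fromList⁻ (a ∷ b ∷ []) v∈
    ... | here refl         = x∈p∩q⁺ (∈₁ , ∈₁)
    ... | there (here refl) = x∈p∩q⁺ (∈₂ , ∈₂)
    ... | there (there ())

  adjacent-step : ∀ {a b c d} → Edge₃ a b c → Edge₃ a b d → c ≢ d →
                  TightWalk H (triple a b c) (triple a b d)
  adjacent-step abc abd c≢d = step abc (∣triple∩triple∣ abc abd c≢d) (single abd)

  adjacent-shape : ∀ {e f} → Edge H e → Edge H f → ∣ e ∩ f ∣ ≡ 2 →
                   ∃₂ λ a b → ∃₂ λ p q → e ≡ triple a b p × f ≡ triple a b q × p ≢ q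
  adjacent-shape {e} {f} e∈H f∈H ∣e∩f∣≡2 with ∣p∣≡2⇒pair ∣e∩f∣≡2
  ... | a , b , a∈e∩f , b∈e∩f , a≢b with x∈p∩q⁻ e f a∈e∩f | x∈p∩q⁻ e f b∈e∩f
  ... | a∈e , a∈f | b∈e , b∈f
    with ∣p∣≡3⇒triple (edgeSize H e e∈H) a∈e b∈e a≢b | ∣p∣≡3⇒triple (edgeSize H f f∈H) a∈f b∈f a≢b
  ... | p , refl | q , refl with p ≟ q
  ...   | no p≢q   = a , b , p , q , refl , refl , p≢q
  ...   | yes refl with trans (sym (edgeSize H e e∈H)) (trans (cong ∣_∣ (sym (∩-idem e))) ∣e∩f∣≡2)
  ...     | ()

  Near-adjacent : ∀ {x e f} → Edge H e → Edge H f → ∣ e ∩ f ∣ ≡ 2 → Near x e → Near x f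
  Near-adjacent e∈H f∈H ∣e∩f∣≡2 with adjacent-shape e∈H f∈H ∣e∩f∣≡2
  ... | _ , _ , _ , _ , refl , refl , p≢q = Near-step e∈H f∈H p≢q

  Near-walk : ∀ {x e f} → TightWalk H e f → Near x e → Near x f
  Near-walk (single _)            near = near
  Near-walk (step e∈H ∣e∩f∣≡2 w) near = Near-walk w (Near-adjacent e∈H (walk-source w) ∣e∩f∣≡2 near)

  walk-between : ∀ {u w h₁ h₂} → Edge H h₁ → Edge H h₂ →
                 u ∈ h₁ → w ∈ h₁ → u ∈ h₂ → w ∈ h₂ → u ≢ w → TightWalk H h₁ h₂
  walk-between h₁∈H h₂∈H u∈h₁ w∈h₁ u∈h₂ w∈h₂ u≢w
    with ∣p∣≡3⇒triple (edgeSize H _ h₁∈H) u∈h₁ w∈h₁ u≢w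
       | ∣p∣≡3⇒triple (edgeSize H _ h₂∈H) u∈h₂ w∈h₂ u≢w
  ... | s , refl | t , refl with s ≟ t
  ...   | yes refl = single h₁∈H
  ...   | no  s≢t  = adjacent-step h₁∈H h₂∈H s≢t

  walk-to-pair : ∀ {u w g} → Edge H g → w ∈ g → Near u g → ∃ λ h → TightWalk H g h × u ∈ h × w ∈ h
  walk-to-pair g∈H w∈g (inj₁ u∈g) = _ , single g∈H , u∈g , w∈g
  walk-to-pair {u} g∈H w∈g (inj₂ (a , b , a∈g , b∈g , uab)) with Edge₃-distinct uab
  ... | _ , _ , a≢b with ∣p∣≡3⇒triple (edgeSize H _ g∈H) a∈g b∈g a≢b
  ... | r , refl with r ≟ u
  ...   | yes refl = _ , single g∈H , ∈₃ , w∈g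
  ...   | no r≢u with Edge₃-distinct g∈H | ∈-fromList⁻ (a ∷ b ∷ r ∷ []) w∈g
  ...     | _ | here refl                 = _ , walk-between g∈H (rotate uab) ∈₁ ∈₂ ∈₁ ∈₂ a≢b , ∈₃ , ∈₁
  ...     | _ | there (here refl)         = _ , walk-between g∈H (rotate uab) ∈₁ ∈₂ ∈₁ ∈₂ a≢b , ∈₃ , ∈₂
  ...     | _ | there (there (there ()))
  ...     | _ , a≢r , b≢r | there (there (here refl)) with third-edge g∈H (rotate uab) r≢u
  ...       | inj₁ bru = _ , walk-between g∈H bru ∈₂ ∈₃ ∈₁ ∈₂ b≢r , ∈₃ , ∈₂
  ...       | inj₂ aru = _ , walk-between g∈H aru ∈₁ ∈₃ ∈₁ ∈₂ a≢r , ∈₃ , ∈₂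

  walk-to-shared-pair : ∀ {C u w} → Connected H C → VertexOf C u → VertexOf C w →
                        ∃ λ g → C g × ∃ λ h → TightWalk H g h × u ∈ h × w ∈ h
  walk-to-shared-pair conn (e , e∈C , u∈e) (g , g∈C , w∈g) =
    g , g∈C , walk-to-pair (proj₁ conn g g∈C) w∈g (Near-walk (connected-walk conn e∈C g∈C) (inj₁ u∈e))

  shared-pair⇒linked : ∀ {C₁ C₂ u w} → Connected H C₁ → Connected H C₂ → u ≢ w →
                       VertexOf C₁ u → VertexOf C₂ u → VertexOf C₁ w → VertexOf C₂ w →
                       ∃₂ λ g₁ g₂ → C₁ g₁ × C₂ g₂ × TightWalk H g₁ g₂
  shared-pair⇒linked conn₁ conn₂ u≢w u∈V₁ u∈V₂ w∈V₁ w∈V₂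
    with walk-to-shared-pair conn₁ u∈V₁ w∈V₁ | walk-to-shared-pair conn₂ u∈V₂ w∈V₂
  ... | g₁ , g₁∈C₁ , h₁ , g₁⇝h₁ , u∈h₁ , w∈h₁ | g₂ , g₂∈C₂ , h₂ , g₂⇝h₂ , u∈h₂ , w∈h₂ =
    g₁ , g₂ , g₁∈C₁ , g₂∈C₂ ,
    g₁⇝h₁ ++ʷ walk-between (walk-target g₁⇝h₁) (walk-target g₂⇝h₂) u∈h₁ w∈h₁ u∈h₂ w∈h₂ u≢w
          ++ʷ reverseʷ g₂⇝h₂

lemma4p2 : ∀ {n} (H : ThreeGraph n) → Free42-44 H →
    (C₁ C₂ : EdgeSet n) → TightComponent H C₁ → TightComponent H C₂ →
    DistinctE C₁ C₂ →
    ∀ (u w : Fin n) → VertexOf C₁ u → VertexOf C₂ u →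
      VertexOf C₁ w → VertexOf C₂ w → u ≡ w
lemma4p2 H free C₁ C₂ comp₁ comp₂ C₁≠C₂ u w u∈V₁ u∈V₂ w∈V₁ w∈V₂ with u ≟ w
... | yes u≡w = u≡w
... | no  u≢w
  with Free42-44Graph.shared-pair⇒linked H free (proj₁ comp₁) (proj₁ comp₂) u≢w u∈V₁ u∈V₂ w∈V₁ w∈V₂
... | g₁ , g₂ , g₁∈C₁ , g₂∈C₂ , g₁⇝g₂ =
  contradiction (linked-components-coincide comp₁ comp₂ g₁∈C₁ g₂∈C₂ g₁⇝g₂) C₁≠C₂
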